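{- Let $G$ be a graph, $\mathcal{W}$ an edge clique cover of $G$, and $C$ a block of $G$. Let $\{\mathcal{W}_1,\mathcal{W}_2,\mathcal{W}_o\}$ be a partition of $\mathcal{W}$ into good parts with $\mathcal{W}_1\cup\mathcal{W}_2\subseteq\mathcal{W}[C]$, and let $C'$ be a block of $G$ with $C'\in\mathcal{C}(\mathcal{W}_o)$ and $N(C)=N(C')$. Let $\Omega=V(G)\setminus V(G,\mathcal{W}_1,\mathcal{W}_2,\mathcal{W}_o)$, and let $H$ be any graph with $V(H)=N[C]$ and $$E(H)=\Omega^2\cup\bigcup_{C_i\in\mathcal{C}(\mathcal{W}_1)\cup\mathcal{C}(\mathcal{W}_2)\cup(\mathcal{C}(\mathcal{W}_o)\setminus\mathcal{C}(G\setminus N(C)))}E(H_i),$$ where each $H_i$ is any triangulation of $R(C_i)$. Then $H$ is a triangulation of $R(C)$.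
   Context: Graphs are finite, simple and undirected. For a vertex set $X$, $X^2$ denotes the edge set of the complete graph on $X$; $N(X)$ is the set of vertices outside $X$ adjacent to $X$, $N[X]=N(X)\cup X$; $\mathcal{C}(G')$ is the set of vertex sets of connected components of a graph $G'$. A full component of $S$ is a $C\in\mathcal{C}(G\setminus S)$ with $N(C)=S$; a minimal separator is a set with at least two full components. A block of $G$ is a vertex set $C$ that is a connected component of $G\setminus N(C)$ with $N(C)$ a minimal separator. The realization $R(C)$ is the graph with vertex set $N[C]$ and edge set $E(G[N[C]])\cup N(C)^2$. A triangulation of a graph $G'$ is a chordal graph $H$ with $V(H)=V(G')$ and $E(G')\subseteq E(H)$. An edge clique cover of $G$ is a collection $\mathcal{W}$ of cliques with every edge inside some member. $\mathcal{W}[X]=\{W\in\mathcal{W}:W\cap X\ne\emptyset\}$. A part is a nonempty $\mathcal{W}'\subseteq\mathcal{W}$; $V(G,\mathcal{W}')=\{v:\{W\in\mathcal{W}:v\in W\}\subseteq\mathcal{W}'\}$; $V(G,\mathcal{W}_1,\dots,\mathcal{W}_p)=V(G,\mathcal{W}_1)\cup\dots\cup V(G,\mathcal{W}_p)$; $\mathcal{C}(\mathcal{W}')=\mathcal{C}(G[V(G,\mathcal{W}')])$. A part is good if every member of $\mathcal{C}(\mathcal{W}')$ is a block. -}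

module Defs where

open import Data.Nat using (ℕ; zero; suc; _+_; _≤_)
open import Data.Bool using (Bool; true; false; not; _∧_; _∨_; T)
open import Data.Fin using (Fin; zero; suc; toℕ; inject₁; fromℕ)
open import Data.Fin.Subset using (Subset; _∈_; _∉_; _⊆_; ∁; _∪_; Nonempty)
open import Data.Vec using (lookup; tabulate)
open import Data.Product using (Σ; ∃; _×_; _,_)
open import Data.Sum using (_⊎_)
open import Relation.Nullary using (¬_)
open import Relation.Binary.PropositionalEquality using (_≡_; _≢_)
open import Function.Definitions using (Injective)

record Graph (n : ℕ) : Set where
  field
    adj    : Fin n → Fin n → Bool
    sym    : ∀ u v → adj u v ≡ adj v u
    irrefl : ∀ v → adj v v ≡ false

Edge : ∀ {n} → Graph n → Fin n → Fin n → Set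
Edge G u v = T (Graph.adj G u v)

anyF : ∀ {n} → (Fin n → Bool) → Bool
anyF {zero}  f = false
anyF {suc n} f = f zero ∨ anyF (λ i → f (suc i))

allF : ∀ {n} → (Fin n → Bool) → Bool
allF {zero}  f = true
allF {suc n} f = f zero ∧ allF (λ i → f (suc i))

N : ∀ {n} → Graph n → Subset n → Subset n
N G X = tabulate λ v → not (lookup X v) ∧ anyF (λ u → lookup X u ∧ Graph.adj G u v)

N[_,_] : ∀ {n} → Graph n → Subset n → Subset n
N[ G , X ] = N G X ∪ X

Sq : ∀ {n} → Subset n → Fin n → Fin n → Set
Sq X u v = u ∈ X × v ∈ X × u ≢ v

data Walk {n} (G : Graph n) (S : Subset n) : Fin n → Fin n → Set where
  here : ∀ {u} → u ∈ S → Walk G S u u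
  step : ∀ {u v w} → u ∈ S → Edge G u v → Walk G S v w → Walk G S u w

IsComponent : ∀ {n} → Graph n → Subset n → Subset n → Set
IsComponent G S C =
  C ⊆ S × Nonempty C ×
  (∀ u v → u ∈ C → v ∈ C → Walk G C u v) ×
  (∀ u v → u ∈ C → v ∈ S → Edge G u v → v ∈ C)

ComponentOfMinus : ∀ {n} → Graph n → Subset n → Subset n → Set
ComponentOfMinus G S C = IsComponent G (∁ S) C

FullComponent : ∀ {n} → Graph n → Subset n → Subset n → Set
FullComponent G S C = ComponentOfMinus G S C × N G C ≡ S

MinimalSeparator : ∀ {n} → Graph n → Subset n → Set
MinimalSeparator G S =
  Σ (Subset _) λ C₁ → Σ (Subset _) λ C₂ →
    C₁ ≢ C₂ × FullComponent G S C₁ × FullComponent G S C₂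

Block : ∀ {n} → Graph n → Subset n → Set
Block G C = ComponentOfMinus G (N G C) C × MinimalSeparator G (N G C)

record SGraph (n : ℕ) : Set₁ where
  field
    V      : Subset n
    E      : Fin n → Fin n → Set
    E-sym  : ∀ {u v} → E u v → E v u
    E-irr  : ∀ {v} → ¬ E v v
    E-in   : ∀ {u v} → E u v → u ∈ V × v ∈ V

-- Edge set of the realization R(C): E(G[N[C]]) ∪ N(C)²  (vertex set N[C])
REdge : ∀ {n} → Graph n → Subset n → Fin n → Fin n → Set
REdge G C u v =
  (u ∈ N[ G , C ] × v ∈ N[ G , C ] × Edge G u v) ⊎ Sq (N G C) u v

-- A cycle c 0, …, c k (k ≥ 3, distinct vertices) with c i ~ c (i+1) and c k ~ c 0;
-- a chord is an edge c i ~ c j with i + 2 ≤ j and (i , j) ≠ (0 , k).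
Chordal : ∀ {n} → (Fin n → Fin n → Set) → Set
Chordal {n} E =
  ∀ (k : ℕ) → 3 ≤ k → (c : Fin (suc k) → Fin n) → Injective _≡_ _≡_ c →
  (∀ (i : Fin k) → E (c (inject₁ i)) (c (suc i))) →
  E (c (fromℕ k)) (c zero) →
  Σ (Fin (suc k)) λ i → Σ (Fin (suc k)) λ j →
    toℕ i + 2 ≤ toℕ j × ¬ (toℕ i ≡ 0 × toℕ j ≡ k) × E (c i) (c j)

IsTriangulation : ∀ {n} → SGraph n → Subset n → (Fin n → Fin n → Set) → Set
IsTriangulation H V E =
  SGraph.V H ≡ V × (∀ u v → E u v → SGraph.E H u v) × Chordal (SGraph.E H)

-- Edge clique covers (a set of cliques, indexed injectively by Fin m)

IsEdgeCliqueCover : ∀ {n m} → Graph n → (Fin m → Subset n) → Set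
IsEdgeCliqueCover G W =
  Injective _≡_ _≡_ W ×
  (∀ i u v → u ∈ W i → v ∈ W i → u ≢ v → Edge G u v) ×
  (∀ u v → Edge G u v → ∃ λ i → u ∈ W i × v ∈ W i)

-- 𝒲' ⊆ 𝒲[X]  (every clique in the part meets X)
PartMeets : ∀ {n m} → (Fin m → Subset n) → Subset m → Subset n → Set
PartMeets W P X = ∀ i → i ∈ P → ∃ λ v → v ∈ W i × v ∈ X

-- V(G, 𝒲') = { v : {W ∈ 𝒲 : v ∈ W} ⊆ 𝒲' }
VP : ∀ {n m} → (Fin m → Subset n) → Subset m → Subset n
VP W P = tabulate λ v → allF (λ i → not (lookup (W i) v) ∨ lookup P i)

GoodPart : ∀ {n m} → Graph n → (Fin m → Subset n) → Subset m → Set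
GoodPart G W P = Nonempty P × (∀ C → IsComponent G (VP W P) C → Block G C)

IsPartition3 : ∀ {m} → Subset m → Subset m → Subset m → Set
IsPartition3 P₁ P₂ P₃ =
  (∀ i → i ∈ P₁ ⊎ i ∈ P₂ ⊎ i ∈ P₃) ×
  (∀ i → i ∈ P₁ → i ∉ P₂) × (∀ i → i ∈ P₁ → i ∉ P₃) × (∀ i → i ∈ P₂ → i ∉ P₃)

-- The key observation is that the boundary N(X) of
-- a component X of G[V(G,P)], P one of the parts, lies in Ω: an edge leaving X lies
-- in a clique of P, which belongs to no other part.  In particular N(C) = N(C′) ⊆ Ω.
-- (i) R(C) ⊆ H: N(C)² ⊆ Ω², and a G-edge in N[C] at a vertex u ∉ Ω is an edge of
--     R(X) for the component X of u (a glued one), hence an edge of Hs X ⊆ H.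
-- (ii) H is chordal by a general gluing lemma: a clique Ω with chordal pieces F X
--     attached along boundary cliques is chordal.  A cycle lies in Ω, or inside one
--     piece, or — by a crossing lemma for cycles — meets the boundary clique of a
--     piece at two non-consecutive positions, which gives a chord.

module Submission where

open import Defs
open import Data.Nat using (ℕ; zero; suc; _+_; _≤_; _<_; z≤n; s≤s)
open import Data.Nat.Properties
  using (≤-refl; ≤-trans; <⇒≤; <⇒≢; ≤-pred; ≤∧≢⇒<; <-≤-trans; <-cmp; n≢0⇒n>0; m<n⇒n≢0;
         m≤n⇒m≤1+n; m<n⇒m<1+n; m≤m+n; m<m+n; m≤n⇒m<n∨m≡n; m⊓n≤n; m≤n⇒m⊓n≡m; +-comm)
open import Data.Bool using (Bool; true; false; not; _∧_; _∨_; T)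
open import Data.Bool.Properties using (T-≡; T-∧; T-∨)
open import Data.Fin using (Fin; zero; suc; toℕ; inject₁; fromℕ; fromℕ<)
open import Data.Fin.Properties using (any?; all?; ¬∀⟶∃¬; toℕ-injective; toℕ-fromℕ<; toℕ-inject₁; toℕ-fromℕ; toℕ≤pred[n])
open import Data.Fin.Subset using (Subset; _∈_; _∉_; _⊆_; _⊃_; ∁; _∪_; ⁅_⁆; Nonempty)
open import Data.Fin.Subset.Properties
  using (_∈?_; ⊆-antisym; x∈⁅x⁆; x∈⁅y⁆⇒x≡y; x∈p∪q⁺; x∈p∪q⁻; p⊆p∪q; x∈∁p⇒x∉p; x∉∁p⇒x∈p; x∉p⇒x∈∁p)
open import Data.Fin.Subset.Induction using (Acc; acc; ⊃-wellFounded)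
open import Data.Vec using (lookup; tabulate)
open import Data.Vec.Properties using (lookup∘tabulate; []=⇒lookup; lookup⇒[]=)
open import Data.Product using (Σ; ∃; _×_; _,_; proj₁; proj₂)
open import Data.Sum using (_⊎_; inj₁; inj₂)
open import Data.Empty using (⊥-elim)
open import Function using (_∘_; _⇔_; Equivalence; mk⇔)
open import Relation.Nullary using (¬_; Dec; yes; no; ¬?; contradiction)
open import Relation.Nullary.Decidable using (T?; _×-dec_)
open import Relation.Unary using (Decidable)
open import Function.Definitions using (Injective)
open import Relation.Binary using (tri<; tri≈; tri>)
open import Relation.Binary.PropositionalEquality
  using (_≡_; _≢_; refl; sym; trans; cong; subst; subst₂)

open Equivalence using (to; from)

∈⇔T : ∀ {n} {x : Fin n} {p : Subset n} → x ∈ p ⇔ T (lookup p x)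
∈⇔T {x = x} {p} = mk⇔ (from T-≡ ∘ []=⇒lookup) (lookup⇒[]= x p ∘ to T-≡)

∈-tabulate : ∀ {n} {f : Fin n → Bool} {x} → x ∈ tabulate f ⇔ T (f x)
∈-tabulate {f = f} {x} = mk⇔
  (λ m → subst T (lookup∘tabulate f x) (to ∈⇔T m))
  (λ t → from ∈⇔T (subst T (sym (lookup∘tabulate f x)) t))

∉⇒T-not : ∀ {n} {x : Fin n} {p : Subset n} → x ∉ p → T (not (lookup p x))
∉⇒T-not {x = x} {p} x∉p with lookup p x in eq
... | true  = x∉p (from ∈⇔T (subst T (sym eq) _))
... | false = _

T-not⇒∉ : ∀ {n} {x : Fin n} {p : Subset n} → T (not (lookup p x)) → x ∉ p
T-not⇒∉ {x = x} {p} t x∈p with lookup p x | to ∈⇔T x∈p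
... | true | _ = t

anyF-sound : ∀ {n} (f : Fin n → Bool) → T (anyF f) → ∃ λ i → T (f i)
anyF-sound {suc n} f t with to T-∨ t
... | inj₁ t₀ = zero , t₀
... | inj₂ t′ with anyF-sound (f ∘ suc) t′
... | i , tᵢ = suc i , tᵢ

anyF-complete : ∀ {n} (f : Fin n → Bool) i → T (f i) → T (anyF f)
anyF-complete {suc n} f zero    t = from T-∨ (inj₁ t)
anyF-complete {suc n} f (suc i) t = from T-∨ (inj₂ (anyF-complete (f ∘ suc) i t))

allF-sound : ∀ {n} (f : Fin n → Bool) → T (allF f) → ∀ i → T (f i)
allF-sound {suc n} f t zero    = proj₁ (to T-∧ t)
allF-sound {suc n} f t (suc i) = allF-sound (f ∘ suc) (proj₂ (to T-∧ t)) i

module _ {n} (G : Graph n) where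

  Edge-sym : ∀ {u v} → Edge G u v → Edge G v u
  Edge-sym {u} {v} = subst T (Graph.sym G u v)

  Edge-irr : ∀ {u} → ¬ Edge G u u
  Edge-irr {u} = subst T (Graph.irrefl G u)

  Edge⇒≢ : ∀ {u v} → Edge G u v → u ≢ v
  Edge⇒≢ e refl = Edge-irr e

  ∈N⁻ : ∀ {X v} → v ∈ N G X → v ∉ X × ∃ λ u → u ∈ X × Edge G u v
  ∈N⁻ {X} {v} v∈N with to T-∧ (to ∈-tabulate v∈N)
  ... | v∉X , t with anyF-sound (λ u → lookup X u ∧ Graph.adj G u v) t
  ... | u , tᵤ = T-not⇒∉ v∉X , u , from ∈⇔T (proj₁ (to T-∧ tᵤ)) , proj₂ (to T-∧ tᵤ)

  ∈N⁺ : ∀ {X u v} → v ∉ X → u ∈ X → Edge G u v → v ∈ N G X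
  ∈N⁺ {X} {u} {v} v∉X u∈X e = from ∈-tabulate (from T-∧ (∉⇒T-not v∉X ,
    anyF-complete (λ w → lookup X w ∧ Graph.adj G w v) u (from T-∧ (to ∈⇔T u∈X , e))))

∈VP⇒part : ∀ {n m} (W : Fin m → Subset n) {P v j} → v ∈ VP W P → v ∈ W j → j ∈ P
∈VP⇒part W {P} {v} {j} v∈VP v∈Wj
  with to T-∨ (allF-sound (λ i → not (lookup (W i) v) ∨ lookup P i) (to ∈-tabulate v∈VP) j)
... | inj₁ v∉Wj = contradiction v∈Wj (T-not⇒∉ v∉Wj)
... | inj₂ j∈P  = from ∈⇔T j∈P

module _ {n} {G : Graph n} where

  walk-mono : ∀ {X Y a b} → X ⊆ Y → Walk G X a b → Walk G Y a b
  walk-mono X⊆Y (here a∈X)       = here (X⊆Y a∈X)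
  walk-mono X⊆Y (step a∈X e w) = step (X⊆Y a∈X) e (walk-mono X⊆Y w)

  walk-snoc : ∀ {X a b c} → Walk G X a b → Edge G b c → c ∈ X → Walk G X a c
  walk-snoc (here a∈X)      e c∈X = step a∈X e (here c∈X)
  walk-snoc (step a∈X e′ w) e c∈X = step a∈X e′ (walk-snoc w e c∈X)

  walk-reverse : ∀ {X a b} → Walk G X a b → Walk G X b a
  walk-reverse (here a∈X)     = here a∈X
  walk-reverse (step a∈X e w) = walk-snoc (walk-reverse w) (Edge-sym G e) a∈X

  walk-append : ∀ {X a b c} → Walk G X a b → Walk G X b c → Walk G X a c
  walk-append (here _)       w′ = w′
  walk-append (step a∈X e w) w′ = step a∈X e (walk-append w w′)

  walk-start : ∀ {X a b} → Walk G X a b → a ∈ X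
  walk-start (here a∈X)     = a∈X
  walk-start (step a∈X _ _) = a∈X

  component-walk-closed : ∀ {S X Z a b} → IsComponent G S X → Z ⊆ S → a ∈ X → Walk G Z a b → b ∈ X
  component-walk-closed cX Z⊆S a∈X (here _)     = a∈X
  component-walk-closed cX Z⊆S a∈X (step _ e w) =
    component-walk-closed cX Z⊆S (proj₂ (proj₂ (proj₂ cX)) _ _ a∈X (Z⊆S (walk-start w)) e) w

  components-meeting-coincide : ∀ {S X Y u} → IsComponent G S X → IsComponent G S Y →
                                u ∈ X → u ∈ Y → X ≡ Y
  components-meeting-coincide {S} {u = u} cX cY u∈X u∈Y =
    ⊆-antisym (inside cX cY u∈X u∈Y) (inside cY cX u∈Y u∈X)
    where
    inside : ∀ {X Y} → IsComponent G S X → IsComponent G S Y → u ∈ X → u ∈ Y → X ⊆ Y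
    inside cX cY u∈X u∈Y {b} b∈X =
      component-walk-closed cY (proj₁ cX) u∈Y (proj₁ (proj₂ (proj₂ cX)) u b u∈X b∈X)

  walk-from-isolated : ∀ {X u b} → (∀ w → ¬ Edge G u w) → Walk G X u b → u ≡ b
  walk-from-isolated isolated (here _)     = refl
  walk-from-isolated isolated (step _ e _) = ⊥-elim (isolated _ e)

  isolated-closed-neighbourhood : ∀ {S Y u v} → IsComponent G S Y → u ∈ Y →
                                  (∀ w → ¬ Edge G u w) → v ∈ N[ G , Y ] → v ≡ u
  isolated-closed-neighbourhood {Y = Y} {u} {v} (_ , _ , connected , _) u∈Y isolated v∈NY
    with x∈p∪q⁻ (N G Y) Y v∈NY
  ... | inj₂ v∈Y = sym (walk-from-isolated isolated (connected u v u∈Y v∈Y))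
  ... | inj₁ v∈N with ∈N⁻ G v∈N
  ...   | _ , y , y∈Y , e =
    ⊥-elim (isolated v (subst (λ z → Edge G z v) (sym (walk-from-isolated isolated (connected u y u∈Y y∈Y))) e))

-- Every vertex u of S lies in a component of G[S]: grow a connected set
-- containing u one vertex at a time (well-founded on ⊃) until no edge leaves it within S.

module _ {n} (G : Graph n) (S : Subset n) where

  Connected∋ : Fin n → Subset n → Set
  Connected∋ u X = u ∈ X × X ⊆ S × (∀ v → v ∈ X → Walk G X u v)

  Exit : Subset n → Set
  Exit X = ∃ λ a → ∃ λ b → a ∈ X × b ∈ S × b ∉ X × Edge G a b

  exit? : ∀ X → Dec (Exit X)
  exit? X = any? λ a → any? λ b →
    (a ∈? X) ×-dec (b ∈? S) ×-dec ¬? (b ∈? X) ×-dec T? (Graph.adj G a b)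

  extend : ∀ {u X a b} → Connected∋ u X → a ∈ X → b ∈ S → Edge G a b → Connected∋ u (X ∪ ⁅ b ⁆)
  extend {u} {X} {a} {b} (u∈X , X⊆S , walks) a∈X b∈S e =
    p⊆p∪q _ u∈X , within-S , walks′
    where
    within-S : X ∪ ⁅ b ⁆ ⊆ S
    within-S v∈ with x∈p∪q⁻ X ⁅ b ⁆ v∈
    ... | inj₁ v∈X = X⊆S v∈X
    ... | inj₂ v∈b rewrite x∈⁅y⁆⇒x≡y b v∈b = b∈S
    walks′ : ∀ v → v ∈ X ∪ ⁅ b ⁆ → Walk G (X ∪ ⁅ b ⁆) u v
    walks′ v v∈ with x∈p∪q⁻ X ⁅ b ⁆ v∈
    ... | inj₁ v∈X = walk-mono (p⊆p∪q _) (walks v v∈X)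
    ... | inj₂ v∈b rewrite x∈⁅y⁆⇒x≡y b v∈b =
      walk-snoc (walk-mono (p⊆p∪q _) (walks a a∈X)) e (x∈p∪q⁺ (inj₂ (x∈⁅x⁆ b)))

  closed⇒component : ∀ {u X} → Connected∋ u X → ¬ Exit X → IsComponent G S X
  closed⇒component {u} {X} (u∈X , X⊆S , walks) no-exit =
    X⊆S , (u , u∈X) ,
    (λ a b a∈X b∈X → walk-append (walk-reverse (walks a a∈X)) (walks b b∈X)) ,
    closed
    where
    closed : ∀ a b → a ∈ X → b ∈ S → Edge G a b → b ∈ X
    closed a b a∈X b∈S e with b ∈? X
    ... | yes b∈X = b∈X
    ... | no  b∉X = contradiction (a , b , a∈X , b∈S , b∉X , e) no-exit

  grow : ∀ {u} X → Acc _⊃_ X → Connected∋ u X → Σ (Subset n) λ Y → IsComponent G S Y × u ∈ Y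
  grow X (acc smaller) cX with exit? X
  ... | no  no-exit = X , closed⇒component cX no-exit , proj₁ cX
  ... | yes (a , b , a∈X , b∈S , b∉X , e) =
    grow (X ∪ ⁅ b ⁆) (smaller (p⊆p∪q _ , b , x∈p∪q⁺ (inj₂ (x∈⁅x⁆ b)) , b∉X)) (extend cX a∈X b∈S e)

  component-of : ∀ {u} → u ∈ S → Σ (Subset n) λ Y → IsComponent G S Y × u ∈ Y
  component-of {u} u∈S = grow ⁅ u ⁆ (⊃-wellFounded ⁅ u ⁆) (x∈⁅x⁆ u , singleton⊆S , walks)
    where
    singleton⊆S : ⁅ u ⁆ ⊆ S
    singleton⊆S v∈ rewrite x∈⁅y⁆⇒x≡y u v∈ = u∈S
    walks : ∀ v → v ∈ ⁅ u ⁆ → Walk G ⁅ u ⁆ u v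
    walks v v∈ rewrite x∈⁅y⁆⇒x≡y u v∈ = here (x∈⁅x⁆ u)

module CycleCrossing {A : Set} (R : A → A → Set) (R-sym : ∀ {x y} → R x y → R y x)
  (I B : A → Set) (I? : Decidable I) (leave : ∀ {x y} → I x → R x y → I y ⊎ B y)
  (k : ℕ) (d : ℕ → A) (edge : ∀ i → i < k → R (d i) (d (suc i))) (wrap : R (d k) (d 0)) where

  exit-forward : ∀ {l r} → l < r → r ≤ k → I (d l) → ¬ I (d r) → ∃ λ t → l < t × t ≤ r × B (d t)
  exit-forward {l} {suc r} l<r r<k Il ¬Ir with I? (d r)
  ... | yes Ir with leave Ir (edge r r<k)
  ...   | inj₁ Ir′ = contradiction Ir′ ¬Ir
  ...   | inj₂ Br′ = suc r , l<r , ≤-refl , Br′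
  exit-forward {l} {suc r} l<r r<k Il ¬Ir | no ¬Ir′
    with exit-forward (≤∧≢⇒< (≤-pred l<r) λ { refl → ¬Ir′ Il }) (<⇒≤ r<k) Il ¬Ir′
  ... | t , l<t , t≤r , Bt = t , l<t , m≤n⇒m≤1+n t≤r , Bt

  exit-backward : ∀ {l r} → l < r → r ≤ k → I (d r) → ¬ I (d l) → ∃ λ t → l ≤ t × t < r × B (d t)
  exit-backward {l} {suc r} l<r r<k Ir ¬Il with leave Ir (R-sym (edge r r<k))
  ... | inj₂ Br′ = r , ≤-pred l<r , ≤-refl , Br′
  ... | inj₁ Ir′ with exit-backward (≤∧≢⇒< (≤-pred l<r) λ { refl → ¬Il Ir′ }) (<⇒≤ r<k) Ir′ ¬Il
  ...   | t , l≤t , t<r , Bt = t , l≤t , m<n⇒m<1+n t<r , Bt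

  Crossing : Set
  Crossing = Σ ℕ λ a → Σ ℕ λ b →
    a + 2 ≤ b × b ≤ k × ¬ (a ≡ 0 × b ≡ k) × B (d a) × B (d b)

  private
    gap : ∀ {a m b} → a < m → m < b → a + 2 ≤ b
    gap {a} {m} {b} a<m m<b = subst (_≤ b) (+-comm 2 a) (≤-trans (s≤s a<m) m<b)

    not-first : ∀ {a b} → a ≢ 0 → ¬ (a ≡ 0 × b ≡ k)
    not-first a≢0 (a≡0 , _) = a≢0 a≡0

    not-last : ∀ {a b} → b ≢ k → ¬ (a ≡ 0 × b ≡ k)
    not-last b≢k (_ , b≡k) = b≢k b≡k

    apart : ∀ (P : A → Set) {s t} → P (d s) → ¬ P (d t) → s ≢ t
    apart _ Ps ¬Pt refl = ¬Pt Ps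

  -- if I comes before the outside position q, one boundary position lies on the arc
  -- from p to q and the other on the arc from q over the wrap-around back to p
  crossing-< : ∀ {p q} → p < q → q ≤ k → I (d p) → ¬ I (d q) → ¬ B (d q) → Crossing
  crossing-< {p} {q} p<q q≤k Ip ¬Iq ¬Bq with exit-forward p<q q≤k Ip ¬Iq
  ... | t₁ , p<t₁ , t₁≤q , Bt₁ with I? (d 0) | I? (d k)
  ...   | no ¬I₀ | _
        with exit-backward (n≢0⇒n>0 (apart I Ip ¬I₀)) (≤-trans (<⇒≤ p<q) q≤k) Ip ¬I₀
  ...     | t₂ , _ , t₂<p , Bt₂ =
          t₂ , t₁ , gap t₂<p p<t₁ , t₁≤k , not-last (<⇒≢ (<-≤-trans t₁<q q≤k)) , Bt₂ , Bt₁
    where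
    t₁<q = ≤∧≢⇒< t₁≤q (apart B Bt₁ ¬Bq)
    t₁≤k = ≤-trans t₁≤q q≤k
  crossing-< {p} {q} p<q q≤k Ip ¬Iq ¬Bq | t₁ , p<t₁ , t₁≤q , Bt₁ | yes I₀ | yes Iₖ
        with exit-backward (≤∧≢⇒< q≤k (apart I Iₖ ¬Iq ∘ sym)) ≤-refl Iₖ ¬Iq
  ...     | t₂ , q≤t₂ , t₂<k , Bt₂ =
          t₁ , t₂ , gap (≤∧≢⇒< t₁≤q (apart B Bt₁ ¬Bq)) (≤∧≢⇒< q≤t₂ (apart B Bt₂ ¬Bq ∘ sym)) ,
          <⇒≤ t₂<k , not-last (<⇒≢ t₂<k) , Bt₁ , Bt₂
  crossing-< {p} {q} p<q q≤k Ip ¬Iq ¬Bq | t₁ , p<t₁ , t₁≤q , Bt₁ | yes I₀ | no ¬Iₖ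
        with leave I₀ (R-sym wrap)
  ...     | inj₁ Iₖ = contradiction Iₖ ¬Iₖ
  ...     | inj₂ Bₖ =
          t₁ , k , gap (≤∧≢⇒< t₁≤q (apart B Bt₁ ¬Bq)) (≤∧≢⇒< q≤k (apart B Bₖ ¬Bq ∘ sym)) ,
          ≤-refl , not-first (m<n⇒n≢0 p<t₁) , Bt₁ , Bₖ

  crossing-> : ∀ {p q} → q < p → p ≤ k → I (d p) → ¬ I (d q) → ¬ B (d q) → Crossing
  crossing-> {p} {q} q<p p≤k Ip ¬Iq ¬Bq with exit-backward q<p p≤k Ip ¬Iq
  ... | t₁ , q≤t₁ , t₁<p , Bt₁ with I? (d k) | I? (d 0)
  ...   | no ¬Iₖ | _
        with exit-forward (≤∧≢⇒< p≤k (apart I Ip ¬Iₖ)) ≤-refl Ip ¬Iₖ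
  ...     | t₂ , p<t₂ , t₂≤k , Bt₂ =
          t₁ , t₂ , gap t₁<p p<t₂ , t₂≤k , not-first (m<n⇒n≢0 (≤∧≢⇒< q≤t₁ (apart B Bt₁ ¬Bq ∘ sym))) ,
          Bt₁ , Bt₂
  crossing-> {p} {q} q<p p≤k Ip ¬Iq ¬Bq | t₁ , q≤t₁ , t₁<p , Bt₁ | yes Iₖ | yes I₀
        with exit-forward (n≢0⇒n>0 (apart I I₀ ¬Iq ∘ sym)) (≤-trans (<⇒≤ q<p) p≤k) I₀ ¬Iq
  ...     | t₂ , _ , t₂≤q , Bt₂ =
          t₂ , t₁ , gap (≤∧≢⇒< t₂≤q (apart B Bt₂ ¬Bq)) (≤∧≢⇒< q≤t₁ (apart B Bt₁ ¬Bq ∘ sym)) ,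
          <⇒≤ (<-≤-trans t₁<p p≤k) , not-last (<⇒≢ (<-≤-trans t₁<p p≤k)) , Bt₂ , Bt₁
  crossing-> {p} {q} q<p p≤k Ip ¬Iq ¬Bq | t₁ , q≤t₁ , t₁<p , Bt₁ | yes Iₖ | no ¬I₀
        with leave Iₖ wrap
  ...     | inj₁ I₀ = contradiction I₀ ¬I₀
  ...     | inj₂ B₀ =
          0 , t₁ , gap (n≢0⇒n>0 (apart B B₀ ¬Bq ∘ sym)) (≤∧≢⇒< q≤t₁ (apart B Bt₁ ¬Bq ∘ sym)) ,
          <⇒≤ (<-≤-trans t₁<p p≤k) , not-last (<⇒≢ (<-≤-trans t₁<p p≤k)) , B₀ , Bt₁

  crossing : ∀ {p q} → p ≤ k → q ≤ k → I (d p) → ¬ I (d q) → ¬ B (d q) → Crossing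
  crossing {p} {q} p≤k q≤k Ip ¬Iq ¬Bq with <-cmp p q
  ... | tri< p<q _ _ = crossing-< p<q q≤k Ip ¬Iq ¬Bq
  ... | tri≈ _ refl _ = contradiction Ip ¬Iq
  ... | tri> _ _ q<p = crossing-> q<p p≤k Ip ¬Iq ¬Bq

Chord : ∀ {n} → (Fin n → Fin n → Set) → ∀ k → (Fin (suc k) → Fin n) → Set
Chord E k c = Σ (Fin (suc k)) λ i → Σ (Fin (suc k)) λ j →
  toℕ i + 2 ≤ toℕ j × ¬ (toℕ i ≡ 0 × toℕ j ≡ k) × E (c i) (c j)

all-or-counterexample : ∀ {n} {P : Fin n → Set} → Decidable P → (∀ i → P i) ⊎ ∃ λ i → ¬ P i
all-or-counterexample {n} {P} P? with all? P?
... | yes everywhere = inj₁ everywhere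
... | no  ¬everywhere = inj₂ (¬∀⟶∃¬ n P P? ¬everywhere)

-- A cycle indexed by Fin (suc k) read as a sequence d : ℕ → Fin n
-- (positions beyond k are clamped), in the form used by `CycleCrossing`.
module CycleAsSequence {n} (E : Fin n → Fin n → Set) (k : ℕ) (c : Fin (suc k) → Fin n)
  (edges : ∀ (i : Fin k) → E (c (inject₁ i)) (c (suc i))) (wrap : E (c (fromℕ k)) (c zero)) where

  position : ℕ → Fin (suc k)
  position i = fromℕ< (s≤s (m⊓n≤n i k))

  toℕ-position : ∀ {i} → i ≤ k → toℕ (position i) ≡ i
  toℕ-position i≤k = trans (toℕ-fromℕ< _) (m≤n⇒m⊓n≡m i≤k)

  position-toℕ : ∀ x → position (toℕ x) ≡ x
  position-toℕ x = toℕ-injective (toℕ-position (toℕ≤pred[n] x))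

  d : ℕ → Fin n
  d = c ∘ position

  d-toℕ : ∀ x → d (toℕ x) ≡ c x
  d-toℕ x = cong c (position-toℕ x)

  edge : ∀ i → i < k → E (d i) (d (suc i))
  edge i i<k = subst₂ E (cong c (toℕ-injective this)) (cong c (toℕ-injective next)) (edges (fromℕ< i<k))
    where
    this : toℕ (inject₁ (fromℕ< i<k)) ≡ toℕ (position i)
    this = trans (toℕ-inject₁ _) (trans (toℕ-fromℕ< i<k) (sym (toℕ-position (<⇒≤ i<k))))
    next : toℕ (suc (fromℕ< i<k)) ≡ toℕ (position (suc i))
    next = trans (cong suc (toℕ-fromℕ< i<k)) (sym (toℕ-position i<k))

  wrapℕ : E (d k) (d 0)
  wrapℕ = subst₂ E (cong c (toℕ-injective (trans (toℕ-fromℕ k) (sym (toℕ-position ≤-refl)))))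
                   (cong c (toℕ-injective (sym (toℕ-position z≤n)))) wrap

  outgoing : ∀ x → ∃ λ v → E (c x) v
  outgoing x with m≤n⇒m<n∨m≡n (toℕ≤pred[n] x)
  ... | inj₁ x<k  = d (suc (toℕ x)) , subst (λ u → E u (d (suc (toℕ x)))) (d-toℕ x) (edge (toℕ x) x<k)
  ... | inj₂ x≡k  = d 0 , subst (λ u → E u (d 0)) (trans (cong d (sym x≡k)) (d-toℕ x)) wrapℕ

  d-injective : Injective _≡_ _≡_ c → ∀ {a b} → a ≤ k → b ≤ k → d a ≡ d b → a ≡ b
  d-injective c-inj a≤k b≤k eq =
    trans (sym (toℕ-position a≤k)) (trans (cong toℕ (c-inj eq)) (toℕ-position b≤k))

  chord : ∀ {a b} → a + 2 ≤ b → b ≤ k → ¬ (a ≡ 0 × b ≡ k) → E (d a) (d b) → Chord E k c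
  chord {a} {b} gap b≤k not-wrap e =
    position a , position b ,
    subst₂ (λ i j → i + 2 ≤ j) (sym (toℕ-position a≤k)) (sym (toℕ-position b≤k)) gap ,
    (λ { (i≡0 , j≡k) → not-wrap (trans (sym (toℕ-position a≤k)) i≡0 , trans (sym (toℕ-position b≤k)) j≡k) }) ,
    e
    where
    a≤k : a ≤ k
    a≤k = ≤-trans (m≤m+n a 2) (≤-trans gap b≤k)

module Gluing {n} {Piece : Set}
  (E : Fin n → Fin n → Set) (E-sym : ∀ {u v} → E u v → E v u) (E-irr : ∀ {v} → ¬ E v v)
  (Ω : Subset n) (Ω-clique : ∀ {u v} → u ∈ Ω → v ∈ Ω → u ≢ v → E u v)
  (Int Bd : Piece → Subset n) (F : Piece → Fin n → Fin n → Set)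
  (F-sym : ∀ X {u v} → F X u v → F X v u)
  (F⊆E : ∀ X {u v} → F X u v → E u v)
  (F-within : ∀ X {u v} → F X u v → v ∈ Bd X ∪ Int X)
  (F-chordal : ∀ X → Chordal (F X))
  (Bd-clique : ∀ X {u v} → u ∈ Bd X → v ∈ Bd X → u ≢ v → F X u v)
  (piece-at : ∀ {u v} → u ∉ Ω → E u v → Σ Piece λ X → u ∈ Int X)
  (interior-local : ∀ X {u v} → u ∈ Int X → E u v → F X u v) where

  local : ∀ X {u v} → u ∈ Bd X ∪ Int X → v ∈ Bd X ∪ Int X → E u v → F X u v
  local X {u} {v} u∈X v∈X e with x∈p∪q⁻ (Bd X) (Int X) u∈X | x∈p∪q⁻ (Bd X) (Int X) v∈X
  ... | inj₂ u∈I | _        = interior-local X u∈I e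
  ... | inj₁ _   | inj₂ v∈I = F-sym X (interior-local X v∈I (E-sym e))
  ... | inj₁ u∈B | inj₁ v∈B = Bd-clique X u∈B v∈B λ { refl → E-irr e }

  leave : ∀ X {u v} → u ∈ Int X → E u v → v ∈ Int X ⊎ v ∈ Bd X
  leave X u∈I e with x∈p∪q⁻ (Bd X) (Int X) (F-within X (interior-local X u∈I e))
  ... | inj₁ v∈B = inj₂ v∈B
  ... | inj₂ v∈I = inj₁ v∈I

  chord-in-Ω : ∀ k → 3 ≤ k → (c : Fin (suc k) → Fin n) → Injective _≡_ _≡_ c →
               (∀ x → c x ∈ Ω) → Chord E k c
  chord-in-Ω (suc (suc (suc k))) (s≤s (s≤s (s≤s _))) c c-inj in-Ω =
    zero , suc (suc zero) , ≤-refl , (λ { (_ , ()) }) ,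
    Ω-clique (in-Ω _) (in-Ω _) (λ eq → contradiction (c-inj eq) λ ())

  module _ (k : ℕ) (3≤k : 3 ≤ k) (c : Fin (suc k) → Fin n) (c-inj : Injective _≡_ _≡_ c)
           (edges : ∀ (i : Fin k) → E (c (inject₁ i)) (c (suc i))) (wrap : E (c (fromℕ k)) (c zero)) where

    open CycleAsSequence E k c edges wrap

    -- a cycle through the interior of X has a chord: inside F X if the cycle stays
    -- in X, otherwise between two non-consecutive boundary vertices
    chord-through : ∀ X p → c p ∈ Int X → Chord E k c
    chord-through X p cp∈I with all-or-counterexample (λ x → c x ∈? Bd X ∪ Int X)
    ... | inj₁ in-X with F-chordal X k 3≤k c c-inj (λ i → local X (in-X _) (in-X _) (edges i))
                                                   (local X (in-X _) (in-X _) wrap)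
    ...   | i , j , gap , not-wrap , f = i , j , gap , not-wrap , F⊆E X f
    chord-through X p cp∈I | inj₂ (q , cq∉X)
      with Crossing.crossing (toℕ≤pred[n] p) (toℕ≤pred[n] q)
             (subst (_∈ Int X) (sym (d-toℕ p)) cp∈I)
             (λ dq∈I → cq∉X (x∈p∪q⁺ (inj₂ (subst (_∈ Int X) (d-toℕ q) dq∈I))))
             (λ dq∈B → cq∉X (x∈p∪q⁺ (inj₁ (subst (_∈ Bd X) (d-toℕ q) dq∈B))))
      where
      module Crossing = CycleCrossing E E-sym (_∈ Int X) (_∈ Bd X) (_∈? Int X) (leave X) k d edge wrapℕ
    ... | a , b , gap , b≤k , not-wrap , Ba , Bb =
      chord gap b≤k not-wrap (F⊆E X (Bd-clique X Ba Bb distinct))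
      where
      distinct : d a ≢ d b
      distinct eq = <⇒≢ (<-≤-trans (m<m+n a (s≤s z≤n)) gap)
                        (d-injective c-inj (≤-trans (m≤m+n a 2) (≤-trans gap b≤k)) b≤k eq)

  chordal : Chordal E
  chordal k 3≤k c c-inj edges wrap with all-or-counterexample (λ x → c x ∈? Ω)
  ... | inj₁ in-Ω        = chord-in-Ω k 3≤k c c-inj in-Ω
  ... | inj₂ (p , cp∉Ω) =
    let open CycleAsSequence E k c edges wrap
        X , cp∈I = piece-at cp∉Ω (proj₂ (outgoing p))
    in chord-through k 3≤k c c-inj edges wrap X p cp∈I

Disjoint : ∀ {m} → Subset m → Subset m → Set
Disjoint P Q = ∀ j → j ∈ P → j ∉ Q

disjoint-sym : ∀ {m} {P Q : Subset m} → Disjoint P Q → Disjoint Q P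
disjoint-sym P∩Q j j∈Q j∈P = P∩Q j j∈P j∈Q

module _ {n m} (G : Graph n) (W : Fin m → Subset n) where

  boundary-outside-own : ∀ {P X x} → IsComponent G (VP W P) X → x ∈ N G X → x ∉ VP W P
  boundary-outside-own (_ , _ , _ , closed) x∈N x∈VP with ∈N⁻ G x∈N
  ... | x∉X , y , y∈X , e = x∉X (closed y _ y∈X x∈VP e)

  -- ... and outside V(G,Q) for every part Q disjoint from P, since the edge joining
  -- it to the component lies in a clique of P
  boundary-outside-disjoint : IsEdgeCliqueCover G W → ∀ {P Q X x} → Disjoint P Q →
                              IsComponent G (VP W P) X → x ∈ N G X → x ∉ VP W Q
  boundary-outside-disjoint (_ , _ , covered) P∩Q (X⊆VP , _) x∈N x∈VQ with ∈N⁻ G x∈N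
  ... | _ , y , y∈X , e with covered _ _ e
  ...   | j , y∈Wj , x∈Wj = P∩Q j (∈VP⇒part W (X⊆VP y∈X) y∈Wj) (∈VP⇒part W x∈VQ x∈Wj)

  -- a vertex of V(G,P) ∩ V(G,Q) for disjoint P, Q lies in no clique, so it has no neighbour
  no-neighbours : IsEdgeCliqueCover G W → ∀ {P Q v} → Disjoint P Q →
                  v ∈ VP W P → v ∈ VP W Q → ∀ w → ¬ Edge G v w
  no-neighbours (_ , _ , covered) P∩Q v∈VP v∈VQ w e with covered _ _ e
  ... | j , v∈Wj , _ = P∩Q j (∈VP⇒part W v∈VP v∈Wj) (∈VP⇒part W v∈VQ v∈Wj)

module Setting {n m} (G : Graph n) (W : Fin m → Subset n) (C : Subset n)
               (W₁ W₂ Wₒ : Subset m) (Hs : Subset n → SGraph n) where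

  Ω : Subset n
  Ω = ∁ (VP W W₁ ∪ VP W W₂ ∪ VP W Wₒ)

  Glued : Subset n → Set
  Glued Cᵢ = IsComponent G (VP W W₁) Cᵢ ⊎ IsComponent G (VP W W₂) Cᵢ ⊎
             (IsComponent G (VP W Wₒ) Cᵢ × ¬ ComponentOfMinus G (N G C) Cᵢ)

  GluedEdge : Fin n → Fin n → Set
  GluedEdge u v = Sq Ω u v ⊎ Σ (Subset n) λ Cᵢ → Glued Cᵢ × SGraph.E (Hs Cᵢ) u v

  data Part : Set where
    p₁ p₂ pₒ : Part

  ⟦_⟧ : Part → Subset m
  ⟦ p₁ ⟧ = W₁
  ⟦ p₂ ⟧ = W₂
  ⟦ pₒ ⟧ = Wₒ

  glued-part : ∀ {X} → Glued X → Σ Part λ a → IsComponent G (VP W ⟦ a ⟧) X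
  glued-part (inj₁ cX)             = p₁ , cX
  glued-part (inj₂ (inj₁ cX))      = p₂ , cX
  glued-part (inj₂ (inj₂ (cX , _))) = pₒ , cX

  ∈⋃⇒in-part : ∀ {x} → x ∈ VP W W₁ ∪ VP W W₂ ∪ VP W Wₒ → Σ Part λ a → x ∈ VP W ⟦ a ⟧
  ∈⋃⇒in-part x∈⋃ with x∈p∪q⁻ (VP W W₁) _ x∈⋃
  ... | inj₁ x∈V₁ = p₁ , x∈V₁
  ... | inj₂ x∈V₂ₒ with x∈p∪q⁻ (VP W W₂) (VP W Wₒ) x∈V₂ₒ
  ...   | inj₁ x∈V₂ = p₂ , x∈V₂
  ...   | inj₂ x∈Vₒ = pₒ , x∈Vₒ

  in-part⇒∈⋃ : ∀ a {x} → x ∈ VP W ⟦ a ⟧ → x ∈ VP W W₁ ∪ VP W W₂ ∪ VP W Wₒ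
  in-part⇒∈⋃ p₁ x∈ = x∈p∪q⁺ (inj₁ x∈)
  in-part⇒∈⋃ p₂ x∈ = x∈p∪q⁺ (inj₂ (x∈p∪q⁺ (inj₁ x∈)))
  in-part⇒∈⋃ pₒ x∈ = x∈p∪q⁺ (inj₂ (x∈p∪q⁺ (inj₂ x∈)))

  in-part⇒∉Ω : ∀ a {x} → x ∈ VP W ⟦ a ⟧ → x ∉ Ω
  in-part⇒∉Ω a x∈ x∈Ω = x∈∁p⇒x∉p x∈Ω (in-part⇒∈⋃ a x∈)

  ∉Ω⇒in-part : ∀ {x} → x ∉ Ω → Σ Part λ a → x ∈ VP W ⟦ a ⟧
  ∉Ω⇒in-part = ∈⋃⇒in-part ∘ x∉∁p⇒x∈p

  outside-parts⇒Ω : ∀ {x} → (∀ a → x ∉ VP W ⟦ a ⟧) → x ∈ Ω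
  outside-parts⇒Ω outside = x∉p⇒x∈∁p λ x∈⋃ → let a , x∈ = ∈⋃⇒in-part x∈⋃ in outside a x∈

  -- The argument proper, under the hypotheses of the theorem that it uses: C is a
  -- component of G ∖ N(C), W₁ is nonempty, N(C) = N(C′) for a component C′ of
  -- G[V(G,Wₒ)], and H consists exactly of Ω² and the edges of the glued Hs Cᵢ.
  module Proof (ecc : IsEdgeCliqueCover G W) (C-component : ComponentOfMinus G (N G C) C)
           (partition : IsPartition3 W₁ W₂ Wₒ) (W₁-nonempty : Nonempty W₁)
           (meets : PartMeets W (W₁ ∪ W₂) C)
           {C′ : Subset n} (C′-component : IsComponent G (VP W Wₒ) C′) (NC≡NC′ : N G C ≡ N G C′)
           (Hs-triangulates : ∀ Cᵢ → Glued Cᵢ → IsTriangulation (Hs Cᵢ) N[ G , Cᵢ ] (REdge G Cᵢ))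
           (H : SGraph n)
           (H-edges : ∀ u v → SGraph.E H u v → GluedEdge u v)
           (H-has : ∀ u v → GluedEdge u v → SGraph.E H u v) where

    open SGraph using (E; E-sym; E-irr; E-in)

    W₁∩Wₒ : Disjoint W₁ Wₒ
    W₁∩Wₒ = proj₁ (proj₂ (proj₂ partition))

    same-or-disjoint : ∀ a b → a ≡ b ⊎ Disjoint ⟦ a ⟧ ⟦ b ⟧
    same-or-disjoint p₁ p₁ = inj₁ refl
    same-or-disjoint p₂ p₂ = inj₁ refl
    same-or-disjoint pₒ pₒ = inj₁ refl
    same-or-disjoint p₁ p₂ = inj₂ (proj₁ (proj₂ partition))
    same-or-disjoint p₁ pₒ = inj₂ W₁∩Wₒ
    same-or-disjoint p₂ pₒ = inj₂ (proj₂ (proj₂ (proj₂ partition)))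
    same-or-disjoint p₂ p₁ = inj₂ (disjoint-sym (proj₁ (proj₂ partition)))
    same-or-disjoint pₒ p₁ = inj₂ (disjoint-sym W₁∩Wₒ)
    same-or-disjoint pₒ p₂ = inj₂ (disjoint-sym (proj₂ (proj₂ (proj₂ partition))))

    boundary⊆Ω : ∀ a {X} → IsComponent G (VP W ⟦ a ⟧) X → N G X ⊆ Ω
    boundary⊆Ω a {X} cX {x} x∈N = outside-parts⇒Ω outside
      where
      outside : ∀ b → x ∉ VP W ⟦ b ⟧
      outside b with same-or-disjoint a b
      ... | inj₁ refl = boundary-outside-own G W {⟦ a ⟧} cX x∈N
      ... | inj₂ a∩b  = boundary-outside-disjoint G W ecc a∩b cX x∈N

    NC⊆Ω : N G C ⊆ Ω
    NC⊆Ω x∈NC = boundary⊆Ω pₒ C′-component (subst (_ ∈_) NC≡NC′ x∈NC)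

    -- A component X of G[V(G,Wₒ)] meeting N[C] is not a component of G ∖ N(C):
    -- it avoids N(C), and if it met C it would be C, which meets a clique of W₁.
    touching-not-component : ∀ {X u} → IsComponent G (VP W Wₒ) X → u ∈ X → u ∈ N[ G , C ] →
                             ¬ ComponentOfMinus G (N G C) X
    touching-not-component {X} {u} (X⊆Vₒ , _) u∈X u∈NC X-component with x∈p∪q⁻ (N G C) C u∈NC
    ... | inj₁ u∈N = x∈∁p⇒x∉p (proj₁ X-component u∈X) u∈N
    ... | inj₂ u∈C with meets (proj₁ W₁-nonempty) (p⊆p∪q W₂ (proj₂ W₁-nonempty))
    ...   | x , x∈Wi , x∈C =
      W₁∩Wₒ _ (proj₂ W₁-nonempty) (∈VP⇒part W (X⊆Vₒ (subst (x ∈_) C≡X x∈C)) x∈Wi)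
      where
      C≡X : C ≡ X
      C≡X = components-meeting-coincide C-component X-component u∈C u∈X

    glued-at : ∀ a {u} → u ∈ VP W ⟦ a ⟧ → u ∈ N[ G , C ] → Σ (Subset n) λ X → Glued X × u ∈ X
    glued-at a {u} u∈Vₐ u∈NC with component-of G (VP W ⟦ a ⟧) u∈Vₐ
    ... | X , cX , u∈X = X , glued a cX , u∈X
      where
      glued : ∀ b → IsComponent G (VP W ⟦ b ⟧) X → Glued X
      glued p₁ c₁ = inj₁ c₁
      glued p₂ c₂ = inj₂ (inj₁ c₂)
      glued pₒ cₒ = inj₂ (inj₂ (cₒ , touching-not-component cₒ u∈X u∈NC))

    Hs-within : ∀ {X u v} → Glued X → E (Hs X) u v → u ∈ N[ G , X ] × v ∈ N[ G , X ]
    Hs-within {X} gX f =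
      let V≡N[X] = proj₁ (Hs-triangulates X gX) ; u∈V , v∈V = E-in (Hs X) f
      in subst (_ ∈_) V≡N[X] u∈V , subst (_ ∈_) V≡N[X] v∈V

    Hs-boundary-clique : ∀ {X u v} → Glued X → u ∈ N G X → v ∈ N G X → u ≢ v → E (Hs X) u v
    Hs-boundary-clique {X} {u} {v} gX u∈N v∈N u≢v =
      proj₁ (proj₂ (Hs-triangulates X gX)) u v (inj₂ (u∈N , v∈N , u≢v))

    -- An H-edge at a vertex u of a glued component X is an edge of Hs X: it comes from
    -- some Hs Y with u ∈ Y (the boundary of Y lies in Ω); Y = X if both are components
    -- of the same part, and otherwise u lies in no clique, so Hs Y has no edge at u.
    interior-local : ∀ {X u v} → Glued X → u ∈ X → E H u v → E (Hs X) u v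
    interior-local {X} {u} {v} gX u∈X e with glued-part gX | H-edges u v e
    ... | a , cX | inj₁ (u∈Ω , _) = contradiction u∈Ω (in-part⇒∉Ω a (proj₁ cX u∈X))
    ... | a , cX | inj₂ (Y , gY , f) with glued-part gY | x∈p∪q⁻ (N G Y) Y (proj₁ (Hs-within gY f))
    ...   | b , cY | inj₁ u∈NY = contradiction (boundary⊆Ω b cY u∈NY) (in-part⇒∉Ω a (proj₁ cX u∈X))
    ...   | b , cY | inj₂ u∈Y with same-or-disjoint a b
    ...     | inj₁ refl = subst (λ Z → E (Hs Z) u v) (sym (components-meeting-coincide cX cY u∈X u∈Y)) f
    ...     | inj₂ a∩b  = ⊥-elim (E-irr (Hs Y) (subst (E (Hs Y) u) v≡u f))
      where
      v≡u : v ≡ u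
      v≡u = isolated-closed-neighbourhood cY u∈Y
              (no-neighbours G W ecc {⟦ a ⟧} {⟦ b ⟧} a∩b (proj₁ cX u∈X) (proj₁ cY u∈Y)) (proj₂ (Hs-within gY f))

    piece-at : ∀ {u v} → u ∉ Ω → E H u v → Σ (Σ (Subset n) Glued) λ X → u ∈ proj₁ X
    piece-at {u} {v} u∉Ω e with H-edges u v e
    ... | inj₁ (u∈Ω , _) = contradiction u∈Ω u∉Ω
    ... | inj₂ (X , gX , f) with x∈p∪q⁻ (N G X) X (proj₁ (Hs-within gX f))
    ...   | inj₁ u∈NX = contradiction (boundary⊆Ω (proj₁ (glued-part gX)) (proj₂ (glued-part gX)) u∈NX) u∉Ω
    ...   | inj₂ u∈X  = (X , gX) , u∈X

    H-chordal : Chordal (E H)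
    H-chordal = Gluing.chordal (E H) (E-sym H) (E-irr H)
      Ω (λ u∈Ω v∈Ω u≢v → H-has _ _ (inj₁ (u∈Ω , v∈Ω , u≢v)))
      proj₁ (N G ∘ proj₁) (E ∘ Hs ∘ proj₁)
      (λ X → E-sym (Hs (proj₁ X)))
      (λ { (X , gX) f → H-has _ _ (inj₂ (X , gX , f)) })
      (λ { (X , gX) f → proj₂ (Hs-within gX f) })
      (λ { (X , gX) → proj₂ (proj₂ (Hs-triangulates X gX)) })
      (λ { (X , gX) → Hs-boundary-clique gX })
      piece-at
      (λ { (X , gX) → interior-local gX })

    edge-outside-Ω : ∀ {u v} → u ∉ Ω → u ∈ N[ G , C ] → Edge G u v → E H u v
    edge-outside-Ω {u} {v} u∉Ω u∈NC e with ∉Ω⇒in-part u∉Ω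
    ... | a , u∈Vₐ with glued-at a u∈Vₐ u∈NC
    ...   | X , gX , u∈X =
      H-has u v (inj₂ (X , gX , proj₁ (proj₂ (Hs-triangulates X gX)) u v
                                  (inj₁ (x∈p∪q⁺ (inj₂ u∈X) , v∈NX , e))))
      where
      v∈NX : v ∈ N[ G , X ]
      v∈NX with v ∈? X
      ... | yes v∈X = x∈p∪q⁺ (inj₂ v∈X)
      ... | no  v∉X = x∈p∪q⁺ (inj₁ (∈N⁺ G v∉X u∈X e))

    realization-edges : ∀ u v → REdge G C u v → E H u v
    realization-edges u v (inj₂ (u∈N , v∈N , u≢v)) = H-has u v (inj₁ (NC⊆Ω u∈N , NC⊆Ω v∈N , u≢v))
    realization-edges u v (inj₁ (u∈NC , v∈NC , e)) with u ∈? Ω | v ∈? Ω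
    ... | yes u∈Ω | yes v∈Ω = H-has u v (inj₁ (u∈Ω , v∈Ω , Edge⇒≢ G e))
    ... | no  u∉Ω | _        = edge-outside-Ω u∉Ω u∈NC e
    ... | yes _   | no  v∉Ω  = E-sym H (edge-outside-Ω v∉Ω v∈NC (Edge-sym G e))

lemma26 : ∀ {n m} (G : Graph n) (W : Fin m → Subset n) (C : Subset n)
    (W₁ W₂ Wₒ : Subset m) (C' : Subset n)
    (Hs : Subset n → SGraph n) (H : SGraph n) →
    IsEdgeCliqueCover G W →
    Block G C →
    IsPartition3 W₁ W₂ Wₒ →
    GoodPart G W W₁ → GoodPart G W W₂ → GoodPart G W Wₒ →
    PartMeets W (W₁ ∪ W₂) C →
    Block G C' → IsComponent G (VP W Wₒ) C' → N G C ≡ N G C' →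
    (∀ Cᵢ → (IsComponent G (VP W W₁) Cᵢ ⊎ IsComponent G (VP W W₂) Cᵢ ⊎
             (IsComponent G (VP W Wₒ) Cᵢ × ¬ ComponentOfMinus G (N G C) Cᵢ)) →
          IsTriangulation (Hs Cᵢ) N[ G , Cᵢ ] (REdge G Cᵢ)) →
    SGraph.V H ≡ N[ G , C ] →
    (∀ u v → SGraph.E H u v →
       Sq (∁ (VP W W₁ ∪ VP W W₂ ∪ VP W Wₒ)) u v ⊎
       Σ (Subset n) (λ Cᵢ →
         (IsComponent G (VP W W₁) Cᵢ ⊎ IsComponent G (VP W W₂) Cᵢ ⊎
          (IsComponent G (VP W Wₒ) Cᵢ × ¬ ComponentOfMinus G (N G C) Cᵢ)) ×
         SGraph.E (Hs Cᵢ) u v)) →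
    (∀ u v →
       (Sq (∁ (VP W W₁ ∪ VP W W₂ ∪ VP W Wₒ)) u v ⊎
        Σ (Subset n) (λ Cᵢ →
          (IsComponent G (VP W W₁) Cᵢ ⊎ IsComponent G (VP W W₂) Cᵢ ⊎
           (IsComponent G (VP W Wₒ) Cᵢ × ¬ ComponentOfMinus G (N G C) Cᵢ)) ×
          SGraph.E (Hs Cᵢ) u v)) →
       SGraph.E H u v) →
    IsTriangulation H N[ G , C ] (REdge G C)
lemma26 G W C W₁ W₂ Wₒ C' Hs H ecc (C-component , _) partition (W₁-nonempty , _) _ _
        meets _ C'-component NC≡NC' Hs-triangulates V-H H-edges H-has =
  V-H , realization-edges , H-chordal
  where
  open Setting.Proof G W C W₁ W₂ Wₒ Hs ecc C-component partition W₁-nonempty meets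
                     C'-component NC≡NC' Hs-triangulates H H-edges H-has
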